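{- If a graph $G$ of order $n$ has no isolated vertices, then $$\gamma_{\rm sp}(G)\le n-\gamma(G).$$
   Context: All graphs are finite, simple and undirected. For a vertex $v$ of a graph $G$, $N(v)$ denotes the set of vertices adjacent to $v$. For $D\subseteq V(G)$ write $\overline{D}=V(G)\setminus D$. A set $D$ is dominating if every vertex in $\overline{D}$ has a neighbour in $D$; the domination number $\gamma(G)$ is the minimum cardinality of a dominating set. A set $D\subseteq V(G)$ is a super dominating set of $G$ if for every $u\in\overline{D}$ there exists $v\in D$ such that $N(v)\cap\overline{D}=\{u\}$; the super domination number $\gamma_{\rm sp}(G)$ is the minimum cardinality of a super dominating set of $G$. -}

module Defs where

open import Data.Nat using (ℕ; _≤_)
open import Data.Fin using (Fin)
open import Data.Fin.Subset using (Subset; _∈_; _∉_; ∣_∣)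
open import Data.Product using (Σ; _×_; ∃-syntax)
open import Relation.Binary.PropositionalEquality using (_≡_)
open import Relation.Nullary using (¬_)
open import Level using (0ℓ; suc)

record Graph (n : ℕ) : Set₁ where
  field
    Adj   : Fin n → Fin n → Set
    sym   : ∀ {u v} → Adj u v → Adj v u
    irrefl : ∀ {v} → ¬ Adj v v

open Graph public

NoIsolated : ∀ {n} → Graph n → Set
NoIsolated G = ∀ v → ∃[ u ] Adj G v u

IsDominating : ∀ {n} → Graph n → Subset n → Set
IsDominating G D = ∀ u → u ∉ D → ∃[ v ] (v ∈ D × Adj G u v)

IsSuperDominating : ∀ {n} → Graph n → Subset n → Set
IsSuperDominating G D =
  ∀ u → u ∉ D → ∃[ v ] (v ∈ D × Adj G v u × (∀ w → Adj G v w → w ∉ D → w ≡ u))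

IsDominationNumber : ∀ {n} → Graph n → ℕ → Set
IsDominationNumber G k =
  (∃[ D ] (IsDominating G D × ∣ D ∣ ≡ k)) × (∀ D → IsDominating G D → k ≤ ∣ D ∣)

IsSuperDominationNumber : ∀ {n} → Graph n → ℕ → Set
IsSuperDominationNumber G k =
  (∃[ D ] (IsSuperDominating G D × ∣ D ∣ ≡ k)) × (∀ D → IsSuperDominating G D → k ≤ ∣ D ∣)

-- Some minimum dominating set S has the property that every u ∈ S has an
-- external private neighbour v ∉ S with N(v) ∩ S = {u} (Bollobás–Cockayne);
-- for such S the complement V ∖ S is super dominating, so γsp ≤ n − |S| = n − γ.
-- To find S, start from any minimum dominating set. If some u ∈ S has no
-- external private neighbour, minimality forces u to be isolated in G[S]; then
-- swapping u for any neighbour w gives a minimum dominating set with strictly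
-- fewer vertices isolated in G[S], so the process terminates.
module Submission where

open import Defs
open import Data.Nat using (ℕ; zero; suc; _≤_; _<_; _+_; _∸_; z≤n; s≤s; _≤?_)
open import Data.Nat.Properties
  using (≤-trans; <⇒≱; +-suc; +-comm; +-monoʳ-≤; n≤1+n; ∸-monoʳ-≤; module ≤-Reasoning)
open import Data.Nat.Induction using (<-wellFounded)
open import Data.Fin using (Fin; zero; suc)
open import Data.Fin.Properties using (any?; all?; _≟_)
open import Data.Fin.Subset
  using (Subset; inside; outside; _∈_; _∉_; _⊂_; _∪_; _─_; _-_; ⁅_⁆; ∁; ∣_∣)
open import Data.Fin.Subset.Properties
  using ( _∈?_; x∈⁅x⁆; x∈⁅y⁆⇒x≡y; x∉⁅y⁆⇒x≢y; ∣⁅x⁆∣≡1; x∈p∪q⁺; x∈p∪q⁻; p─q⊆p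
        ; x∈p∧x≢y⇒x∈p-y; x∈p⇒∣p-x∣<∣p∣; p⊂q⇒∣p∣<∣q∣; x∉p⇒x∈∁p; x∉∁p⇒x∈p; ∣∁p∣≡n∸∣p∣)
open import Data.Vec using ([]; _∷_; tabulate; here; there)
open import Data.Vec.Properties using (lookup∘tabulate; []=⇒lookup; lookup⇒[]=)
open import Data.Product using (_×_; _,_; proj₁; proj₂; ∃-syntax)
open import Data.Sum using (_⊎_; inj₁; inj₂)
open import Function using (_∘_)
open import Induction.WellFounded using (Acc; acc)
open import Level using (Level)
open import Relation.Binary using () renaming (Decidable to Decidable₂)
open import Relation.Binary.PropositionalEquality as ≡ using (_≡_; _≢_; refl; subst)
open import Relation.Nullary using (¬_; yes; no; does; proof; contradiction; ¬?)
open import Relation.Nullary.Reflects using (Reflects; invert)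
open import Relation.Nullary.Decidable
  using (_×-dec_; _→-dec_; decidable-stable; dec-true; ¬¬-excluded-middle)
open import Relation.Nullary.Negation using (¬¬-map)
open import Relation.Unary using (Pred; Decidable)

¬¬-pull-Fin : ∀ {n ℓ} {P : Pred (Fin n) ℓ} → (∀ i → ¬ ¬ P i) → ¬ ¬ (∀ i → P i)
¬¬-pull-Fin {zero}  ¬¬P ¬∀ = ¬∀ λ ()
¬¬-pull-Fin {suc n} ¬¬P ¬∀ = ¬¬P zero λ P₀ → ¬¬-pull-Fin (¬¬P ∘ suc) λ P₊ →
  ¬∀ λ { zero → P₀ ; (suc i) → P₊ i }

x∈p─q⇒x∉q : ∀ {n} {x : Fin n} (p q : Subset n) → x ∈ p ─ q → x ∉ q
x∈p─q⇒x∉q (_ ∷ p) (outside ∷ q) here          ()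
x∈p─q⇒x∉q (_ ∷ p) (_       ∷ q) (there x∈p─q) (there x∈q) = x∈p─q⇒x∉q p q x∈p─q x∈q

∣p∪q∣≤∣p∣+∣q∣ : ∀ {n} (p q : Subset n) → ∣ p ∪ q ∣ ≤ ∣ p ∣ + ∣ q ∣
∣p∪q∣≤∣p∣+∣q∣ []            []            = z≤n
∣p∪q∣≤∣p∣+∣q∣ (outside ∷ p) (outside ∷ q) = ∣p∪q∣≤∣p∣+∣q∣ p q
∣p∪q∣≤∣p∣+∣q∣ (inside  ∷ p) (outside ∷ q) = s≤s (∣p∪q∣≤∣p∣+∣q∣ p q)
∣p∪q∣≤∣p∣+∣q∣ (outside ∷ p) (inside  ∷ q) =
  subst (suc ∣ p ∪ q ∣ ≤_) (≡.sym (+-suc ∣ p ∣ ∣ q ∣)) (s≤s (∣p∪q∣≤∣p∣+∣q∣ p q))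
∣p∪q∣≤∣p∣+∣q∣ (inside  ∷ p) (inside  ∷ q) =
  s≤s (≤-trans (∣p∪q∣≤∣p∣+∣q∣ p q) (+-monoʳ-≤ ∣ p ∣ (n≤1+n ∣ q ∣)))

module _ {n : ℕ} where

  swap : Subset n → Fin n → Fin n → Subset n
  swap p x z = (p - x) ∪ ⁅ z ⁆

  module _ {x y z : Fin n} {p : Subset n} where

    ∈-swap⁺ : y ∈ p → y ≢ x → y ∈ swap p x z
    ∈-swap⁺ y∈p y≢x = x∈p∪q⁺ (inj₁ (x∈p∧x≢y⇒x∈p-y y∈p y≢x))

    ∈-swap⁻ : y ∈ swap p x z → y ≡ z ⊎ (y ∈ p × y ≢ x)
    ∈-swap⁻ y∈ with x∈p∪q⁻ (p - x) ⁅ z ⁆ y∈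
    ... | inj₁ y∈p-x = inj₂ (p─q⊆p p ⁅ x ⁆ y∈p-x , x∉⁅y⁆⇒x≢y (x∈p─q⇒x∉q p ⁅ x ⁆ y∈p-x))
    ... | inj₂ y∈⁅z⁆ = inj₁ (x∈⁅y⁆⇒x≡y z y∈⁅z⁆)

  z∈swap : ∀ {x z : Fin n} {p : Subset n} → z ∈ swap p x z
  z∈swap {z = z} = x∈p∪q⁺ (inj₂ (x∈⁅x⁆ z))

  ∣swap∣≤∣p∣ : ∀ {x : Fin n} {p : Subset n} (z : Fin n) → x ∈ p → ∣ swap p x z ∣ ≤ ∣ p ∣
  ∣swap∣≤∣p∣ {x} {p} z x∈p = begin
    ∣ (p - x) ∪ ⁅ z ⁆ ∣   ≤⟨ ∣p∪q∣≤∣p∣+∣q∣ (p - x) ⁅ z ⁆ ⟩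
    ∣ p - x ∣ + ∣ ⁅ z ⁆ ∣ ≡⟨ ≡.cong (∣ p - x ∣ +_) (∣⁅x⁆∣≡1 z) ⟩
    ∣ p - x ∣ + 1         ≡⟨ +-comm ∣ p - x ∣ 1 ⟩
    1 + ∣ p - x ∣         ≤⟨ x∈p⇒∣p-x∣<∣p∣ x∈p ⟩
    ∣ p ∣                 ∎
    where open ≤-Reasoning

  subsetOf : ∀ {ℓ} {P : Pred (Fin n) ℓ} → Decidable P → Subset n
  subsetOf P? = tabulate (does ∘ P?)

  module _ {ℓ : Level} {P : Pred (Fin n) ℓ} (P? : Decidable P) {x : Fin n} where

    ∈-subsetOf⁺ : P x → x ∈ subsetOf P?
    ∈-subsetOf⁺ Px = lookup⇒[]= x _ (≡.trans (lookup∘tabulate _ x) (dec-true (P? x) Px))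

    ∈-subsetOf⁻ : x ∈ subsetOf P? → P x
    ∈-subsetOf⁻ x∈ =
      invert (subst (Reflects (P x)) (≡.trans (≡.sym (lookup∘tabulate _ x)) ([]=⇒lookup x∈)) (proof (P? x)))

module _ {n : ℕ} (G : Graph n) where

  ExternalPrivateNeighbour : Subset n → Fin n → Fin n → Set
  ExternalPrivateNeighbour S u v = v ∉ S × Adj G v u × (∀ w → Adj G v w → w ∈ S → w ≡ u)

  HasExternalPrivateNeighbour : Subset n → Fin n → Set
  HasExternalPrivateNeighbour S u = ∃[ v ] ExternalPrivateNeighbour S u v

  IsolatedIn : Subset n → Fin n → Set
  IsolatedIn S u = u ∈ S × (∀ z → z ∈ S → ¬ Adj G u z)

  IsMinimumDominating : Subset n → Set
  IsMinimumDominating S = IsDominating G S × (∀ D → IsDominating G D → ∣ S ∣ ≤ ∣ D ∣)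

  ∁-superDominating : ∀ {S} → (∀ u → u ∈ S → HasExternalPrivateNeighbour S u) →
                      IsSuperDominating G (∁ S)
  ∁-superDominating epn u u∉∁S with epn u (x∉∁p⇒x∈p u∉∁S)
  ... | v , v∉S , vu , unique = v , x∉p⇒x∈∁p v∉S , vu , λ w vw → unique w vw ∘ x∉∁p⇒x∈p

  module _ (adj? : Decidable₂ (Adj G)) where

    hasExternalPrivateNeighbour? : ∀ S → Decidable (HasExternalPrivateNeighbour S)
    hasExternalPrivateNeighbour? S u = any? λ v →
      ¬? (v ∈? S) ×-dec adj? v u ×-dec all? λ w → adj? v w →-dec (w ∈? S →-dec w ≟ u)

    isolatedIn? : ∀ S → Decidable (IsolatedIn S)
    isolatedIn? S u = u ∈? S ×-dec all? λ z → z ∈? S →-dec ¬? (adj? u z)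

    isolatedSet : Subset n → Subset n
    isolatedSet S = subsetOf (isolatedIn? S)

    anotherNeighbour : ∀ {S u x} → ¬ HasExternalPrivateNeighbour S u → x ∉ S → Adj G x u →
                       ∃[ y ] (y ∈ S × y ≢ u × Adj G x y)
    anotherNeighbour {S} {u} {x} noEPN x∉S xu
      with any? (λ y → y ∈? S ×-dec ¬? (y ≟ u) ×-dec adj? x y)
    ... | yes found = found
    ... | no none = contradiction (x , x∉S , xu , onlyU) noEPN
      where
      onlyU : ∀ y → Adj G x y → y ∈ S → y ≡ u
      onlyU y xy y∈S = decidable-stable (y ≟ u) λ y≢u → none (y , y∈S , y≢u , xy)

    dominatedAvoiding : ∀ {S u} → IsDominating G S → ¬ HasExternalPrivateNeighbour S u →
                        ∀ x → x ∉ S → ∃[ y ] (y ∈ S × y ≢ u × Adj G x y)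
    dominatedAvoiding {S} {u} domS noEPN x x∉S with domS x x∉S
    ... | y , y∈S , xy with y ≟ u
    ... | no y≢u   = y , y∈S , y≢u , xy
    ... | yes refl = anotherNeighbour noEPN x∉S xy

    dominating-remove : ∀ {S u z} → IsDominating G S → ¬ HasExternalPrivateNeighbour S u →
                        z ∈ S → Adj G u z → IsDominating G (S - u)
    dominating-remove {S} {u} {z} domS noEPN z∈S uz x x∉S-u with x ≟ u
    ... | yes refl = z , x∈p∧x≢y⇒x∈p-y z∈S (λ { refl → irrefl G uz }) , uz
    ... | no x≢u with dominatedAvoiding domS noEPN x (x∉S-u ∘ λ x∈S → x∈p∧x≢y⇒x∈p-y x∈S x≢u)
    ... | y , y∈S , y≢u , xy = y , x∈p∧x≢y⇒x∈p-y y∈S y≢u , xy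

    noExternalPrivateNeighbour⇒isolated : ∀ {S u} → IsMinimumDominating S → u ∈ S →
                                          ¬ HasExternalPrivateNeighbour S u → IsolatedIn S u
    noExternalPrivateNeighbour⇒isolated {S} (domS , minS) u∈S noEPN = u∈S , λ z z∈S uz →
      <⇒≱ (x∈p⇒∣p-x∣<∣p∣ u∈S) (minS _ (dominating-remove domS noEPN z∈S uz))

    module Exchange {S u w} (minDomS : IsMinimumDominating S) (u∈S : u ∈ S)
                    (noEPN : ¬ HasExternalPrivateNeighbour S u) (uw : Adj G u w) where

      S′ : Subset n
      S′ = swap S u w

      isolatedU : IsolatedIn S u
      isolatedU = noExternalPrivateNeighbour⇒isolated minDomS u∈S noEPN

      w∉S : w ∉ S
      w∉S w∈S = proj₂ isolatedU w w∈S uw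

      dominating′ : IsDominating G S′
      dominating′ y y∉S′ with y ≟ u
      ... | yes refl = w , z∈swap , uw
      ... | no y≢u with dominatedAvoiding (proj₁ minDomS) noEPN y (y∉S′ ∘ λ y∈S → ∈-swap⁺ y∈S y≢u)
      ... | z , z∈S , z≢u , yz = z , ∈-swap⁺ z∈S z≢u , yz

      minimumDominating′ : IsMinimumDominating S′
      minimumDominating′ = dominating′ , λ D domD → ≤-trans (∣swap∣≤∣p∣ w u∈S) (proj₂ minDomS D domD)

      isolated′⇒isolated : ∀ {y} → IsolatedIn S′ y → IsolatedIn S y
      isolated′⇒isolated {y} (y∈S′ , isolatedY) with ∈-swap⁻ y∈S′
      ... | inj₁ refl with anotherNeighbour noEPN w∉S (sym G uw)
      ...   | x , x∈S , x≢u , wx = contradiction wx (isolatedY x (∈-swap⁺ x∈S x≢u))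
      isolated′⇒isolated {y} (y∈S′ , isolatedY) | inj₂ (y∈S , y≢u) = y∈S , notAdj
        where
        notAdj : ∀ z → z ∈ S → ¬ Adj G y z
        notAdj z z∈S yz with z ≟ u
        ... | yes refl = proj₂ isolatedU y y∈S (sym G yz)
        ... | no z≢u   = isolatedY z (∈-swap⁺ z∈S z≢u) yz

      u∉S′ : u ∉ S′
      u∉S′ u∈S′ with ∈-swap⁻ u∈S′
      ... | inj₁ refl     = w∉S u∈S
      ... | inj₂ (_ , u≢u) = u≢u refl

      isolatedSet-shrinks : isolatedSet S′ ⊂ isolatedSet S
      isolatedSet-shrinks =
          ∈-subsetOf⁺ (isolatedIn? S) ∘ isolated′⇒isolated ∘ ∈-subsetOf⁻ (isolatedIn? S′)
        , u , ∈-subsetOf⁺ (isolatedIn? S) isolatedU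
        , u∉S′ ∘ proj₁ ∘ ∈-subsetOf⁻ (isolatedIn? S′)

    privateMinimumDominating :
      NoIsolated G → ∀ S → Acc _<_ ∣ isolatedSet S ∣ → IsMinimumDominating S →
      ∃[ T ] (IsMinimumDominating T × (∀ u → u ∈ T → HasExternalPrivateNeighbour T u))
    privateMinimumDominating noIso S (acc rs) minDomS
      with any? (λ u → u ∈? S ×-dec ¬? (hasExternalPrivateNeighbour? S u))
    ... | no ¬bad = S , minDomS , λ u u∈S →
      decidable-stable (hasExternalPrivateNeighbour? S u) λ noEPN → ¬bad (u , u∈S , noEPN)
    ... | yes (u , u∈S , noEPN) =
      privateMinimumDominating noIso S′ (rs (p⊂q⇒∣p∣<∣q∣ isolatedSet-shrinks)) minimumDominating′
      where open Exchange minDomS u∈S noEPN (proj₂ (noIso u))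

theorem12 : ∀ (n : ℕ) (G : Graph n) → NoIsolated G →
    ∀ (γ γsp : ℕ) → IsDominationNumber G γ → IsSuperDominationNumber G γsp →
    γsp ≤ n ∸ γ
theorem12 n G noIso γ γsp ((D , domD , ∣D∣≡γ) , minD) (_ , minSp) =
  -- Adjacency need not be decidable, but the goal is, so we may assume it is.
  decidable-stable (γsp ≤? n ∸ γ)
    (¬¬-map bound (¬¬-pull-Fin λ u → ¬¬-pull-Fin λ v → ¬¬-excluded-middle))
  where
  minDomD : IsMinimumDominating G D
  minDomD = domD , λ D′ domD′ → subst (_≤ ∣ D′ ∣) (≡.sym ∣D∣≡γ) (minD D′ domD′)

  bound : Decidable₂ (Adj G) → γsp ≤ n ∸ γ
  bound adj? with privateMinimumDominating G adj? noIso D (<-wellFounded _) minDomD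
  ... | T , (domT , _) , epn = begin
    γsp       ≤⟨ minSp (∁ T) (∁-superDominating G epn) ⟩
    ∣ ∁ T ∣   ≡⟨ ∣∁p∣≡n∸∣p∣ T ⟩
    n ∸ ∣ T ∣ ≤⟨ ∸-monoʳ-≤ n (minD T domT) ⟩
    n ∸ γ     ∎
    where open ≤-Reasoning
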